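{- Let $(\mathsf T,\mu,\eta,\mathsf n,\mathsf n_K)$ be a symmetric comonoidal monad and $(!,\delta,\varepsilon,\Delta,\mathsf e,\mathsf m,\mathsf m_K)$ a monoidal coalgebra modality on the same symmetric monoidal category $(\mathbb X,\otimes,K)$, and let $\lambda$ be a symmetric monoidal mixed distributive law of $(\mathsf T,\mu,\eta,\mathsf n,\mathsf n_K)$ over $(!,\delta,\varepsilon,\mathsf m,\mathsf m_K)$. Then $\lambda$ is a coalgebra mixed distributive law of $(\mathsf T,\mu,\eta,\mathsf n,\mathsf n_K)$ over $(!,\delta,\varepsilon,\Delta,\mathsf e)$; that is, $\Delta_{\mathsf TA}\circ\lambda_A=(\lambda_A\otimes\lambda_A)\circ\mathsf n_{!A,!A}\circ\mathsf T(\Delta_A)$ and $\mathsf e_{\mathsf TA}\circ\lambda_A=\mathsf n_K\circ\mathsf T(\mathsf e_A)$ for all objects $A$.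
   Context: Composition is written $g\circ f$; $(\mathbb X,\otimes,K)$ is symmetric monoidal with unitor $\ell$ and interchange iso $\tau_{A,B,C,D}:(A\otimes B)\otimes(C\otimes D)\to(A\otimes C)\otimes(B\otimes D)$. Symmetric comonoidal monad $(\mathsf T,\mu,\eta,\mathsf n,\mathsf n_K)$: a monad with natural $\mathsf n_{A,B}:\mathsf T(A\otimes B)\to\mathsf TA\otimes\mathsf TB$, $\mathsf n_K:\mathsf TK\to K$ making $\mathsf T$ symmetric comonoidal, with $\mu,\eta$ comonoidal transformations. Monoidal coalgebra modality: comonad $(!,\delta,\varepsilon)$ with lax symmetric monoidal structure $\mathsf m_{A,B}:!A\otimes!B\to!(A\otimes B)$, $\mathsf m_K:K\to!K$ making $\delta,\varepsilon$ monoidal, and natural $\Delta_A:!A\to!A\otimes!A$, $\mathsf e_A:!A\to K$ making each $!A$ a cocommutative comonoid with $\delta_A$ a comonoid morphism, such that $\Delta_{A\otimes B}\circ\mathsf m_{A,B}=(\mathsf m_{A,B}\otimes\mathsf m_{A,B})\circ\tau\circ(\Delta_A\otimes\Delta_B)$, $\mathsf e_{A\otimes B}\circ\mathsf m_{A,B}=\ell_K\circ(\mathsf e_A\otimes\mathsf e_B)$, $\Delta_K\circ\mathsf m_K=(\mathsf m_K\otimes\mathsf m_K)\circ\ell_K^{ -1}$, $\mathsf e_K\circ\mathsf m_K=1_K$, $!(\Delta_A)\circ\delta_A=\mathsf m_{!A,!A}\circ(\delta_A\otimes\delta_A)\circ\Delta_A$, $!(\mathsf e_A)\circ\delta_A=\mathsf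 m_K\circ\mathsf e_A$. A symmetric monoidal mixed distributive law is a natural $\lambda_A:\mathsf T!A\to!\mathsf TA$ with $\lambda_A\circ\mu_{!A}=!(\mu_A)\circ\lambda_{\mathsf TA}\circ\mathsf T(\lambda_A)$, $\lambda_A\circ\eta_{!A}=!(\eta_A)$, $\delta_{\mathsf TA}\circ\lambda_A=!(\lambda_A)\circ\lambda_{!A}\circ\mathsf T(\delta_A)$, $\varepsilon_{\mathsf TA}\circ\lambda_A=\mathsf T(\varepsilon_A)$, $!(\mathsf n_{A,B})\circ\lambda_{A\otimes B}\circ\mathsf T(\mathsf m_{A,B})=\mathsf m_{\mathsf TA,\mathsf TB}\circ(\lambda_A\otimes\lambda_B)\circ\mathsf n_{!A,!B}$ and $!(\mathsf n_K)\circ\lambda_K\circ\mathsf T(\mathsf m_K)=\mathsf m_K\circ\mathsf n_K$. -}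

module Defs where

open import Level using (Level; _⊔_; suc)
open import Relation.Binary using (IsEquivalence)
open import Data.Product using (_×_)

record Category (o h q : Level) : Set (suc (o ⊔ h ⊔ q)) where
  infixr 9 _∘_
  infix  4 _≈_
  field
    Obj     : Set o
    _⇒_     : Obj → Obj → Set h
    _≈_     : ∀ {A B} → A ⇒ B → A ⇒ B → Set q
    ≈-equiv : ∀ {A B} → IsEquivalence (_≈_ {A} {B})
    id      : ∀ {A} → A ⇒ A
    _∘_     : ∀ {A B C} → B ⇒ C → A ⇒ B → A ⇒ C
    assoc     : ∀ {A B C D} {f : A ⇒ B} {g : B ⇒ C} {h : C ⇒ D} →
                (h ∘ g) ∘ f ≈ h ∘ (g ∘ f)
    identityˡ : ∀ {A B} {f : A ⇒ B} → id ∘ f ≈ f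
    identityʳ : ∀ {A B} {f : A ⇒ B} → f ∘ id ≈ f
    ∘-resp-≈  : ∀ {A B C} {f h : B ⇒ C} {g i : A ⇒ B} →
                f ≈ h → g ≈ i → f ∘ g ≈ h ∘ i

record Endofunctor {o h q} (C : Category o h q) : Set (o ⊔ h ⊔ q) where
  open Category C
  field
    F₀ : Obj → Obj
    F₁ : ∀ {A B} → A ⇒ B → F₀ A ⇒ F₀ B
    identity     : ∀ {A} → F₁ (id {A}) ≈ id
    homomorphism : ∀ {A B C} {f : A ⇒ B} {g : B ⇒ C} → F₁ (g ∘ f) ≈ F₁ g ∘ F₁ f
    F-resp-≈     : ∀ {A B} {f g : A ⇒ B} → f ≈ g → F₁ f ≈ F₁ g

record SymmetricMonoidal {o h q} (C : Category o h q) : Set (o ⊔ h ⊔ q) where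
  open Category C
  infixr 10 _⊗₀_ _⊗₁_
  field
    _⊗₀_ : Obj → Obj → Obj
    _⊗₁_ : ∀ {A B C D} → A ⇒ B → C ⇒ D → (A ⊗₀ C) ⇒ (B ⊗₀ D)
    K    : Obj
    ⊗-identity     : ∀ {A B} → (id {A} ⊗₁ id {B}) ≈ id
    ⊗-homomorphism : ∀ {A B C A' B' C'} {f : A ⇒ B} {g : B ⇒ C}
                       {f' : A' ⇒ B'} {g' : B' ⇒ C'} →
                     ((g ∘ f) ⊗₁ (g' ∘ f')) ≈ (g ⊗₁ g') ∘ (f ⊗₁ f')
    ⊗-resp-≈       : ∀ {A B C D} {f g : A ⇒ B} {h i : C ⇒ D} →
                     f ≈ g → h ≈ i → (f ⊗₁ h) ≈ (g ⊗₁ i)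
    α     : ∀ {A B C} → ((A ⊗₀ B) ⊗₀ C) ⇒ (A ⊗₀ (B ⊗₀ C))
    α⁻¹   : ∀ {A B C} → (A ⊗₀ (B ⊗₀ C)) ⇒ ((A ⊗₀ B) ⊗₀ C)
    α-isoˡ : ∀ {A B C} → α⁻¹ ∘ α {A} {B} {C} ≈ id
    α-isoʳ : ∀ {A B C} → α {A} {B} {C} ∘ α⁻¹ ≈ id
    α-natural : ∀ {A B C A' B' C'} {f : A ⇒ A'} {g : B ⇒ B'} {h : C ⇒ C'} →
                α ∘ ((f ⊗₁ g) ⊗₁ h) ≈ (f ⊗₁ (g ⊗₁ h)) ∘ α
    ℓ     : ∀ {A} → (K ⊗₀ A) ⇒ A
    ℓ⁻¹   : ∀ {A} → A ⇒ (K ⊗₀ A)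
    ℓ-isoˡ : ∀ {A} → ℓ⁻¹ ∘ ℓ {A} ≈ id
    ℓ-isoʳ : ∀ {A} → ℓ {A} ∘ ℓ⁻¹ ≈ id
    ℓ-natural : ∀ {A B} {f : A ⇒ B} → ℓ ∘ (id ⊗₁ f) ≈ f ∘ ℓ
    ρ     : ∀ {A} → (A ⊗₀ K) ⇒ A
    ρ⁻¹   : ∀ {A} → A ⇒ (A ⊗₀ K)
    ρ-isoˡ : ∀ {A} → ρ⁻¹ ∘ ρ {A} ≈ id
    ρ-isoʳ : ∀ {A} → ρ {A} ∘ ρ⁻¹ ≈ id
    ρ-natural : ∀ {A B} {f : A ⇒ B} → ρ ∘ (f ⊗₁ id) ≈ f ∘ ρ
    σ     : ∀ {A B} → (A ⊗₀ B) ⇒ (B ⊗₀ A)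
    σ-natural : ∀ {A B C D} {f : A ⇒ B} {g : C ⇒ D} →
                σ ∘ (f ⊗₁ g) ≈ (g ⊗₁ f) ∘ σ
    σ-involutive : ∀ {A B} → σ {B} {A} ∘ σ {A} {B} ≈ id
    pentagon : ∀ {A B C D} →
               (id {A} ⊗₁ α {B} {C} {D}) ∘ α ∘ (α ⊗₁ id) ≈ α ∘ α
    triangle : ∀ {A B} → (id {A} ⊗₁ ℓ {B}) ∘ α ≈ ρ ⊗₁ id
    hexagon  : ∀ {A B C} →
               (id {B} ⊗₁ σ {A} {C}) ∘ α ∘ (σ ⊗₁ id) ≈ α ∘ σ ∘ α

  τ : ∀ {A B C D} → ((A ⊗₀ B) ⊗₀ (C ⊗₀ D)) ⇒ ((A ⊗₀ C) ⊗₀ (B ⊗₀ D))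
  τ = α⁻¹ ∘ (id ⊗₁ α) ∘ (id ⊗₁ (σ ⊗₁ id)) ∘ (id ⊗₁ α⁻¹) ∘ α

record SymmetricComonoidalMonad {o h q} {C : Category o h q}
         (M : SymmetricMonoidal C) : Set (o ⊔ h ⊔ q) where
  open Category C
  open SymmetricMonoidal M
  field
    T : Endofunctor C
  open Endofunctor T public renaming (F₀ to T₀; F₁ to T₁)
  field
    μ  : ∀ {A} → T₀ (T₀ A) ⇒ T₀ A
    η  : ∀ {A} → A ⇒ T₀ A
    μ-natural : ∀ {A B} {f : A ⇒ B} → μ ∘ T₁ (T₁ f) ≈ T₁ f ∘ μ
    η-natural : ∀ {A B} {f : A ⇒ B} → η ∘ f ≈ T₁ f ∘ η
    μ-assoc   : ∀ {A} → μ {A} ∘ T₁ μ ≈ μ ∘ μ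
    μ-identityˡ : ∀ {A} → μ {A} ∘ T₁ η ≈ id
    μ-identityʳ : ∀ {A} → μ {A} ∘ η ≈ id
    n  : ∀ {A B} → T₀ (A ⊗₀ B) ⇒ (T₀ A ⊗₀ T₀ B)
    nK : T₀ K ⇒ K
    n-natural : ∀ {A B C D} {f : A ⇒ B} {g : C ⇒ D} →
                n ∘ T₁ (f ⊗₁ g) ≈ (T₁ f ⊗₁ T₁ g) ∘ n
    n-assoc  : ∀ {A B C} →
               α ∘ (n ⊗₁ id) ∘ n {A ⊗₀ B} {C} ≈ (id ⊗₁ n) ∘ n ∘ T₁ α
    n-unitˡ  : ∀ {A} → ℓ ∘ (nK ⊗₁ id) ∘ n {K} {A} ≈ T₁ ℓ
    n-unitʳ  : ∀ {A} → ρ ∘ (id ⊗₁ nK) ∘ n {A} {K} ≈ T₁ ρ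
    n-symm   : ∀ {A B} → σ ∘ n {A} {B} ≈ n ∘ T₁ σ
    μ-n  : ∀ {A B} → n ∘ μ {A ⊗₀ B} ≈ (μ ⊗₁ μ) ∘ n ∘ T₁ n
    μ-nK : nK ∘ μ ≈ nK ∘ T₁ nK
    η-n  : ∀ {A B} → n ∘ η {A ⊗₀ B} ≈ η ⊗₁ η
    η-nK : nK ∘ η ≈ id

record MonoidalCoalgebraModality {o h q} {C : Category o h q}
         (M : SymmetricMonoidal C) : Set (o ⊔ h ⊔ q) where
  open Category C
  open SymmetricMonoidal M
  field
    Bang : Endofunctor C
  open Endofunctor Bang public renaming (F₀ to !₀; F₁ to !₁)
  field
    δ : ∀ {A} → !₀ A ⇒ !₀ (!₀ A)
    ε : ∀ {A} → !₀ A ⇒ A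
    δ-natural : ∀ {A B} {f : A ⇒ B} → δ ∘ !₁ f ≈ !₁ (!₁ f) ∘ δ
    ε-natural : ∀ {A B} {f : A ⇒ B} → ε ∘ !₁ f ≈ f ∘ ε
    δ-assoc   : ∀ {A} → δ ∘ δ {A} ≈ !₁ δ ∘ δ
    ε-identityˡ : ∀ {A} → ε ∘ δ {A} ≈ id
    ε-identityʳ : ∀ {A} → !₁ ε ∘ δ {A} ≈ id
    m  : ∀ {A B} → (!₀ A ⊗₀ !₀ B) ⇒ !₀ (A ⊗₀ B)
    mK : K ⇒ !₀ K
    m-natural : ∀ {A B C D} {f : A ⇒ B} {g : C ⇒ D} →
                m ∘ (!₁ f ⊗₁ !₁ g) ≈ !₁ (f ⊗₁ g) ∘ m
    m-assoc  : ∀ {A B C} →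
               !₁ α ∘ m {A ⊗₀ B} {C} ∘ (m ⊗₁ id) ≈ m ∘ (id ⊗₁ m) ∘ α
    m-unitˡ  : ∀ {A} → !₁ ℓ ∘ m {K} {A} ∘ (mK ⊗₁ id) ≈ ℓ
    m-unitʳ  : ∀ {A} → !₁ ρ ∘ m {A} {K} ∘ (id ⊗₁ mK) ≈ ρ
    m-symm   : ∀ {A B} → !₁ σ ∘ m {A} {B} ≈ m ∘ σ
    δ-m  : ∀ {A B} → δ ∘ m {A} {B} ≈ !₁ m ∘ m ∘ (δ ⊗₁ δ)
    δ-mK : δ ∘ mK ≈ !₁ mK ∘ mK
    ε-m  : ∀ {A B} → ε ∘ m {A} {B} ≈ ε ⊗₁ ε
    ε-mK : ε ∘ mK ≈ id
    Δ : ∀ {A} → !₀ A ⇒ (!₀ A ⊗₀ !₀ A)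
    e : ∀ {A} → !₀ A ⇒ K
    Δ-natural : ∀ {A B} {f : A ⇒ B} → Δ ∘ !₁ f ≈ (!₁ f ⊗₁ !₁ f) ∘ Δ
    e-natural : ∀ {A B} {f : A ⇒ B} → e ∘ !₁ f ≈ e
    Δ-coassoc : ∀ {A} → α ∘ (Δ ⊗₁ id) ∘ Δ {A} ≈ (id ⊗₁ Δ) ∘ Δ
    Δ-counitˡ : ∀ {A} → ℓ ∘ (e ⊗₁ id) ∘ Δ {A} ≈ id
    Δ-counitʳ : ∀ {A} → ρ ∘ (id ⊗₁ e) ∘ Δ {A} ≈ id
    Δ-cocomm  : ∀ {A} → σ ∘ Δ {A} ≈ Δ
    δ-Δ : ∀ {A} → Δ ∘ δ {A} ≈ (δ ⊗₁ δ) ∘ Δ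
    δ-e : ∀ {A} → e ∘ δ {A} ≈ e
    Δ-m  : ∀ {A B} → Δ ∘ m {A} {B} ≈ (m ⊗₁ m) ∘ τ ∘ (Δ ⊗₁ Δ)
    e-m  : ∀ {A B} → e ∘ m {A} {B} ≈ ℓ ∘ (e ⊗₁ e)
    Δ-mK : Δ ∘ mK ≈ (mK ⊗₁ mK) ∘ ℓ⁻¹
    e-mK : e ∘ mK ≈ id
    !Δ-δ : ∀ {A} → !₁ Δ ∘ δ {A} ≈ m ∘ (δ ⊗₁ δ) ∘ Δ
    !e-δ : ∀ {A} → !₁ e ∘ δ {A} ≈ mK ∘ e

record SymmetricMonoidalMixedDistributiveLaw {o h q} {C : Category o h q}
         {M : SymmetricMonoidal C} (Tm : SymmetricComonoidalMonad M)
         (B : MonoidalCoalgebraModality M) : Set (o ⊔ h ⊔ q) where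
  open Category C
  open SymmetricMonoidal M
  open SymmetricComonoidalMonad Tm
  open MonoidalCoalgebraModality B
  field
    lam : ∀ {A} → T₀ (!₀ A) ⇒ !₀ (T₀ A)
    lam-natural : ∀ {A B} {f : A ⇒ B} → lam ∘ T₁ (!₁ f) ≈ !₁ (T₁ f) ∘ lam
    lam-μ  : ∀ {A} → lam {A} ∘ μ ≈ !₁ μ ∘ lam ∘ T₁ lam
    lam-η  : ∀ {A} → lam {A} ∘ η ≈ !₁ η
    lam-δ  : ∀ {A} → δ ∘ lam {A} ≈ !₁ lam ∘ lam ∘ T₁ δ
    lam-ε  : ∀ {A} → ε ∘ lam {A} ≈ T₁ ε
    lam-m  : ∀ {A B} → !₁ n ∘ lam ∘ T₁ (m {A} {B}) ≈ m ∘ (lam ⊗₁ lam) ∘ n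
    lam-mK : !₁ nK ∘ lam ∘ T₁ mK ≈ mK ∘ nK

IsCoalgebraMixedDistributiveLaw :
  ∀ {o h q} {C : Category o h q} {M : SymmetricMonoidal C}
    {Tm : SymmetricComonoidalMonad M} {B : MonoidalCoalgebraModality M} →
  SymmetricMonoidalMixedDistributiveLaw Tm B → Set (o ⊔ q)
IsCoalgebraMixedDistributiveLaw {C = C} {M} {Tm} {B} L =
  ∀ (A : Obj) →
    (Δ ∘ lam {A} ≈ (lam ⊗₁ lam) ∘ n ∘ T₁ Δ) × (e ∘ lam {A} ≈ nK ∘ T₁ e)
  where
    open Category C
    open SymmetricMonoidal M
    open SymmetricComonoidalMonad Tm
    open MonoidalCoalgebraModality B
    open SymmetricMonoidalMixedDistributiveLaw L

module Submission where

-- The object T!A carries the !-coalgebra structure κ = λ ∘ Tδ, and the axiom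
-- relating λ and δ says precisely that λ : (T!A, κ) → (!TA, δ) is a coalgebra
-- morphism. Every !-coalgebra (X, c) carries the comonoid ((ε ⊗ ε) ∘ Δ ∘ c, e ∘ c);
-- coalgebra morphisms preserve it, and on a cofree coalgebra (!Y, δ) it is (Δ, e).
-- So both equations reduce to: the comonoid induced by κ is (n ∘ TΔ, n_K ∘ Te),
-- the image of (Δ, e) under the comonoidal functor T. For the counit, n_K ∘ Te
-- is a coalgebra morphism into (K, m_K). For the comultiplication, n ∘ TΔ is a
-- coalgebra morphism into the tensor coalgebra m ∘ (κ ⊗ κ), so the two
-- comultiplications interchange; being counital for the same counit, they agree
-- by the Eckmann–Hilton argument.

open import Defs
open import Level using (Level)
open import Data.Product using (_×_; _,_)
open import Relation.Binary using (Setoid)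
import Relation.Binary.Reasoning.Setoid as SetoidReasoning

module HomReasoning {o h q} (C : Category o h q) where
  open Category C

  hom-setoid : Obj → Obj → Setoid h q
  hom-setoid A B = record { Carrier = A ⇒ B ; _≈_ = _≈_ ; isEquivalence = ≈-equiv }

  module _ {A B : Obj} where
    open Setoid (hom-setoid A B) public
      using () renaming (refl to ≈-refl; sym to ≈-sym; trans to ≈-trans)
    open SetoidReasoning (hom-setoid A B) public

  infixr 4 refl⟩∘⟨_
  infixl 5 _⟩∘⟨refl

  refl⟩∘⟨_ : ∀ {A B C} {f : B ⇒ C} {g i : A ⇒ B} → g ≈ i → f ∘ g ≈ f ∘ i
  refl⟩∘⟨ p = ∘-resp-≈ ≈-refl p

  _⟩∘⟨refl : ∀ {A B C} {f h : B ⇒ C} {g : A ⇒ B} → f ≈ h → f ∘ g ≈ h ∘ g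
  p ⟩∘⟨refl = ∘-resp-≈ p ≈-refl

  pullˡ : ∀ {V W X Y} {a : X ⇒ Y} {b : W ⇒ X} {c : W ⇒ Y} {f : V ⇒ W} →
          a ∘ b ≈ c → a ∘ (b ∘ f) ≈ c ∘ f
  pullˡ p = ≈-trans (≈-sym assoc) (p ⟩∘⟨refl)

  pullˡ₃ : ∀ {U V W X Y} {a : X ⇒ Y} {b : W ⇒ X} {c : V ⇒ W} {d : V ⇒ Y} {f : U ⇒ V} →
           a ∘ b ∘ c ≈ d → a ∘ b ∘ c ∘ f ≈ d ∘ f
  pullˡ₃ p = ≈-trans (refl⟩∘⟨ ≈-sym assoc) (pullˡ p)

  pullʳ : ∀ {V W X Y} {a : X ⇒ Y} {b : W ⇒ X} {c : V ⇒ W} {d : V ⇒ X} →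
          b ∘ c ≈ d → (a ∘ b) ∘ c ≈ a ∘ d
  pullʳ p = ≈-trans assoc (refl⟩∘⟨ p)

  cancelˡ : ∀ {V W X} {a : W ⇒ X} {b : X ⇒ W} {f : V ⇒ X} → a ∘ b ≈ id → a ∘ (b ∘ f) ≈ f
  cancelˡ p = ≈-trans (pullˡ p) identityˡ

  extendʳ : ∀ {U V W W' X} {a : W ⇒ X} {b : V ⇒ W} {c : W' ⇒ X} {d : V ⇒ W'}
              {f : U ⇒ V} → a ∘ b ≈ c ∘ d → a ∘ (b ∘ f) ≈ c ∘ (d ∘ f)
  extendʳ p = ≈-trans (pullˡ p) assoc

  split-epi-cancel : ∀ {X Y Z} {z : X ⇒ Y} {w : Y ⇒ X} {f g : Y ⇒ Z} →
                     z ∘ w ≈ id → f ∘ z ≈ g ∘ z → f ≈ g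
  split-epi-cancel {z = z} {w} {f} {g} zw≈id fz≈gz = begin
    f           ≈⟨ identityʳ ⟨
    f ∘ id      ≈⟨ refl⟩∘⟨ zw≈id ⟨
    f ∘ z ∘ w   ≈⟨ pullˡ fz≈gz ⟩
    (g ∘ z) ∘ w ≈⟨ pullʳ zw≈id ⟩
    g ∘ id      ≈⟨ identityʳ ⟩
    g           ∎

module SymmetricMonoidalProperties {o h q} {C : Category o h q}
         (M : SymmetricMonoidal C) where
  open Category C
  open SymmetricMonoidal M
  open HomReasoning C

  ⊗-resp-≈ˡ : ∀ {A B C D} {f g : A ⇒ B} {k : C ⇒ D} → f ≈ g → f ⊗₁ k ≈ g ⊗₁ k
  ⊗-resp-≈ˡ p = ⊗-resp-≈ p ≈-refl

  ⊗-resp-≈ʳ : ∀ {A B C D} {f g : A ⇒ B} {k : C ⇒ D} → f ≈ g → k ⊗₁ f ≈ k ⊗₁ g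
  ⊗-resp-≈ʳ p = ⊗-resp-≈ ≈-refl p

  id⊗-∘ : ∀ {X A B C} {f : B ⇒ C} {g : A ⇒ B} →
          id {X} ⊗₁ (f ∘ g) ≈ (id ⊗₁ f) ∘ (id ⊗₁ g)
  id⊗-∘ = ≈-trans (⊗-resp-≈ˡ (≈-sym identityˡ)) ⊗-homomorphism

  ∘-⊗id : ∀ {X A B C} {f : B ⇒ C} {g : A ⇒ B} →
          (f ∘ g) ⊗₁ id {X} ≈ (f ⊗₁ id) ∘ (g ⊗₁ id)
  ∘-⊗id = ≈-trans (⊗-resp-≈ʳ (≈-sym identityˡ)) ⊗-homomorphism

  ⊗≈id⊗∘⊗id : ∀ {A B C D} {f : A ⇒ B} {g : C ⇒ D} → f ⊗₁ g ≈ (id ⊗₁ g) ∘ (f ⊗₁ id)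
  ⊗≈id⊗∘⊗id = ≈-trans (⊗-resp-≈ (≈-sym identityˡ) (≈-sym identityʳ)) ⊗-homomorphism

  ⊗≈⊗id∘id⊗ : ∀ {A B C D} {f : A ⇒ B} {g : C ⇒ D} → f ⊗₁ g ≈ (f ⊗₁ id) ∘ (id ⊗₁ g)
  ⊗≈⊗id∘id⊗ = ≈-trans (⊗-resp-≈ (≈-sym identityʳ) (≈-sym identityˡ)) ⊗-homomorphism

  ⊗-homomorphism₃ : ∀ {A B C D A' B' C' D'} {f : A ⇒ B} {g : B ⇒ C} {k : C ⇒ D}
                      {f' : A' ⇒ B'} {g' : B' ⇒ C'} {k' : C' ⇒ D'} →
                    (k ∘ g ∘ f) ⊗₁ (k' ∘ g' ∘ f') ≈ (k ⊗₁ k') ∘ (g ⊗₁ g') ∘ (f ⊗₁ f')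
  ⊗-homomorphism₃ = ≈-trans ⊗-homomorphism (refl⟩∘⟨ ⊗-homomorphism)

  ⊗-square : ∀ {A A' A'' B B' B'' D D'}
               {x : A' ⇒ A''} {f : A ⇒ A'} {f' : D ⇒ A''} {x' : A ⇒ D}
               {y : B' ⇒ B''} {g : B ⇒ B'} {g' : D' ⇒ B''} {y' : B ⇒ D'} →
             x ∘ f ≈ f' ∘ x' → y ∘ g ≈ g' ∘ y' →
             (x ⊗₁ y) ∘ (f ⊗₁ g) ≈ (f' ⊗₁ g') ∘ (x' ⊗₁ y')
  ⊗-square p p' = ≈-trans (≈-sym ⊗-homomorphism) (≈-trans (⊗-resp-≈ p p') ⊗-homomorphism)

  id-square : ∀ {A B} {f : A ⇒ B} → id ∘ f ≈ f ∘ id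
  id-square = ≈-trans identityˡ (≈-sym identityʳ)

  ⊗-cancelˡ-K : ∀ {X Y} {f g : X ⇒ Y} → id {K} ⊗₁ f ≈ id ⊗₁ g → f ≈ g
  ⊗-cancelˡ-K {f = f} {g} p = split-epi-cancel ℓ-isoʳ (begin
    f ∘ ℓ          ≈⟨ ℓ-natural ⟨
    ℓ ∘ (id ⊗₁ f)  ≈⟨ refl⟩∘⟨ p ⟩
    ℓ ∘ (id ⊗₁ g)  ≈⟨ ℓ-natural ⟩
    g ∘ ℓ          ∎)

  ⊗-cancelʳ-K : ∀ {X Y} {f g : X ⇒ Y} → f ⊗₁ id {K} ≈ g ⊗₁ id → f ≈ g
  ⊗-cancelʳ-K {f = f} {g} p = split-epi-cancel ρ-isoʳ (begin
    f ∘ ρ          ≈⟨ ρ-natural ⟨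
    ρ ∘ (f ⊗₁ id)  ≈⟨ refl⟩∘⟨ p ⟩
    ρ ∘ (g ⊗₁ id)  ≈⟨ ρ-natural ⟩
    g ∘ ρ          ∎)

  σ-cancel : ∀ {X A B} {f g : X ⇒ (A ⊗₀ B)} → σ ∘ f ≈ σ ∘ g → f ≈ g
  σ-cancel {f = f} {g} p = begin
    f             ≈⟨ cancelˡ σ-involutive ⟨
    σ ∘ (σ ∘ f)   ≈⟨ refl⟩∘⟨ p ⟩
    σ ∘ (σ ∘ g)   ≈⟨ cancelˡ σ-involutive ⟩
    g             ∎

  α⁻¹-natural : ∀ {A B C A' B' C'} {f : A ⇒ A'} {g : B ⇒ B'} {k : C ⇒ C'} →
                α⁻¹ ∘ (f ⊗₁ (g ⊗₁ k)) ≈ ((f ⊗₁ g) ⊗₁ k) ∘ α⁻¹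
  α⁻¹-natural {f = f} {g} {k} = begin
    α⁻¹ ∘ (f ⊗₁ (g ⊗₁ k))                ≈⟨ refl⟩∘⟨ identityʳ ⟨
    α⁻¹ ∘ (f ⊗₁ (g ⊗₁ k)) ∘ id           ≈⟨ refl⟩∘⟨ refl⟩∘⟨ α-isoʳ ⟨
    α⁻¹ ∘ (f ⊗₁ (g ⊗₁ k)) ∘ α ∘ α⁻¹      ≈⟨ refl⟩∘⟨ extendʳ α-natural ⟨
    α⁻¹ ∘ α ∘ ((f ⊗₁ g) ⊗₁ k) ∘ α⁻¹      ≈⟨ cancelˡ α-isoˡ ⟩
    ((f ⊗₁ g) ⊗₁ k) ∘ α⁻¹                ∎

  triangle⁻¹ : ∀ {A B} → (ρ {A} ⊗₁ id {B}) ∘ α⁻¹ ≈ id ⊗₁ ℓ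
  triangle⁻¹ = begin
    (ρ ⊗₁ id) ∘ α⁻¹          ≈⟨ triangle ⟩∘⟨refl ⟨
    ((id ⊗₁ ℓ) ∘ α) ∘ α⁻¹    ≈⟨ pullʳ α-isoʳ ⟩
    (id ⊗₁ ℓ) ∘ id           ≈⟨ identityʳ ⟩
    id ⊗₁ ℓ                  ∎

  ℓ∘α≈ℓ⊗id : ∀ {A B} → ℓ {A ⊗₀ B} ∘ α {K} {A} {B} ≈ ℓ ⊗₁ id
  ℓ∘α≈ℓ⊗id {A} {B} =
    ⊗-cancelˡ-K (split-epi-cancel α-isoʳ (split-epi-cancel α⊗id-isoʳ pentagon-triangle))
    where
    α⊗id-isoʳ : (α {K} {K} {A} ⊗₁ id {B}) ∘ (α⁻¹ ⊗₁ id) ≈ id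
    α⊗id-isoʳ = begin
      (α ⊗₁ id) ∘ (α⁻¹ ⊗₁ id)  ≈⟨ ⊗-homomorphism ⟨
      (α ∘ α⁻¹) ⊗₁ (id ∘ id)   ≈⟨ ⊗-resp-≈ α-isoʳ identityˡ ⟩
      id ⊗₁ id                 ≈⟨ ⊗-identity ⟩
      id                       ∎

    pentagon-triangle : ((id ⊗₁ (ℓ ∘ α)) ∘ α) ∘ (α ⊗₁ id)
                          ≈ ((id ⊗₁ (ℓ ⊗₁ id)) ∘ α) ∘ (α {K} {K} {A} ⊗₁ id {B})
    pentagon-triangle = begin
      ((id ⊗₁ (ℓ ∘ α)) ∘ α) ∘ (α ⊗₁ id)          ≈⟨ assoc ⟩
      (id ⊗₁ (ℓ ∘ α)) ∘ α ∘ (α ⊗₁ id)            ≈⟨ id⊗-∘ ⟩∘⟨refl ⟩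
      ((id ⊗₁ ℓ) ∘ (id ⊗₁ α)) ∘ α ∘ (α ⊗₁ id)    ≈⟨ pullʳ pentagon ⟩
      (id ⊗₁ ℓ) ∘ α ∘ α                          ≈⟨ pullˡ triangle ⟩
      (ρ ⊗₁ id) ∘ α                              ≈⟨ ⊗-resp-≈ʳ ⊗-identity ⟩∘⟨refl ⟨
      (ρ ⊗₁ (id ⊗₁ id)) ∘ α                      ≈⟨ α-natural ⟨
      α ∘ ((ρ ⊗₁ id) ⊗₁ id)                      ≈⟨ refl⟩∘⟨ ⊗-resp-≈ˡ triangle ⟨
      α ∘ (((id ⊗₁ ℓ) ∘ α) ⊗₁ id)                ≈⟨ refl⟩∘⟨ ∘-⊗id ⟩
      α ∘ ((id ⊗₁ ℓ) ⊗₁ id) ∘ (α ⊗₁ id)          ≈⟨ extendʳ α-natural ⟩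
      (id ⊗₁ (ℓ ⊗₁ id)) ∘ α ∘ (α ⊗₁ id)          ≈⟨ assoc ⟨
      ((id ⊗₁ (ℓ ⊗₁ id)) ∘ α) ∘ (α ⊗₁ id)        ∎

  ℓ∘σ≈ρ : ∀ {A} → ℓ {A} ∘ σ {A} {K} ≈ ρ
  ℓ∘σ≈ρ = ⊗-cancelʳ-K (σ-cancel (begin
    σ ∘ ((ℓ ∘ σ) ⊗₁ id)                ≈⟨ refl⟩∘⟨ ∘-⊗id ⟩
    σ ∘ (ℓ ⊗₁ id) ∘ (σ ⊗₁ id)          ≈⟨ refl⟩∘⟨ ℓ∘α≈ℓ⊗id ⟩∘⟨refl ⟨
    σ ∘ (ℓ ∘ α) ∘ (σ ⊗₁ id)            ≈⟨ refl⟩∘⟨ assoc ⟩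
    σ ∘ ℓ ∘ α ∘ (σ ⊗₁ id)              ≈⟨ extendʳ ℓ-natural ⟨
    ℓ ∘ (id ⊗₁ σ) ∘ α ∘ (σ ⊗₁ id)      ≈⟨ refl⟩∘⟨ hexagon ⟩
    ℓ ∘ α ∘ σ ∘ α                      ≈⟨ pullˡ ℓ∘α≈ℓ⊗id ⟩
    (ℓ ⊗₁ id) ∘ σ ∘ α                  ≈⟨ extendʳ σ-natural ⟨
    σ ∘ (id ⊗₁ ℓ) ∘ α                  ≈⟨ refl⟩∘⟨ triangle ⟩
    σ ∘ (ρ ⊗₁ id)                      ∎))

  τ-natural : ∀ {A A' B B' C C' D D'} {a : A ⇒ A'} {b : B ⇒ B'} {c : C ⇒ C'} {d : D ⇒ D'} →
              τ ∘ ((a ⊗₁ b) ⊗₁ (c ⊗₁ d)) ≈ ((a ⊗₁ c) ⊗₁ (b ⊗₁ d)) ∘ τ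
  τ-natural {a = a} {b} {c} {d} = begin
    (α⁻¹ ∘ (id ⊗₁ α) ∘ (id ⊗₁ (σ ⊗₁ id)) ∘ (id ⊗₁ α⁻¹) ∘ α) ∘ ((a ⊗₁ b) ⊗₁ (c ⊗₁ d))
      ≈⟨ pullʳ (pullʳ (pullʳ (pullʳ α-natural))) ⟩
    α⁻¹ ∘ (id ⊗₁ α) ∘ (id ⊗₁ (σ ⊗₁ id)) ∘ (id ⊗₁ α⁻¹) ∘ (a ⊗₁ (b ⊗₁ (c ⊗₁ d))) ∘ α
      ≈⟨ refl⟩∘⟨ refl⟩∘⟨ refl⟩∘⟨ extendʳ (⊗-square id-square α⁻¹-natural) ⟩
    α⁻¹ ∘ (id ⊗₁ α) ∘ (id ⊗₁ (σ ⊗₁ id)) ∘ (a ⊗₁ ((b ⊗₁ c) ⊗₁ d)) ∘ (id ⊗₁ α⁻¹) ∘ α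
      ≈⟨ refl⟩∘⟨ refl⟩∘⟨ extendʳ (⊗-square id-square (⊗-square σ-natural id-square)) ⟩
    α⁻¹ ∘ (id ⊗₁ α) ∘ (a ⊗₁ ((c ⊗₁ b) ⊗₁ d)) ∘ (id ⊗₁ (σ ⊗₁ id)) ∘ (id ⊗₁ α⁻¹) ∘ α
      ≈⟨ refl⟩∘⟨ extendʳ (⊗-square id-square α-natural) ⟩
    α⁻¹ ∘ (a ⊗₁ (c ⊗₁ (b ⊗₁ d))) ∘ (id ⊗₁ α) ∘ (id ⊗₁ (σ ⊗₁ id)) ∘ (id ⊗₁ α⁻¹) ∘ α
      ≈⟨ extendʳ α⁻¹-natural ⟩
    ((a ⊗₁ c) ⊗₁ (b ⊗₁ d)) ∘ α⁻¹ ∘ (id ⊗₁ α) ∘ (id ⊗₁ (σ ⊗₁ id)) ∘ (id ⊗₁ α⁻¹) ∘ α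
      ∎

  ρ⊗ℓ∘τ≈ρ⊗ℓ : ∀ {A B} → (ρ {A} ⊗₁ ℓ {B}) ∘ τ {A} {K} {K} {B} ≈ ρ ⊗₁ ℓ
  ρ⊗ℓ∘τ≈ρ⊗ℓ {A} {B} = begin
    (ρ ⊗₁ ℓ) ∘ α⁻¹ ∘ (id ⊗₁ α) ∘ (id ⊗₁ (σ ⊗₁ id)) ∘ (id ⊗₁ α⁻¹) ∘ α
      ≈⟨ ⊗≈id⊗∘⊗id ⟩∘⟨refl ⟩
    ((id ⊗₁ ℓ) ∘ (ρ ⊗₁ id)) ∘ α⁻¹ ∘ (id ⊗₁ α) ∘ (id ⊗₁ (σ ⊗₁ id)) ∘ (id ⊗₁ α⁻¹) ∘ α
      ≈⟨ pullʳ (pullˡ triangle⁻¹) ⟩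
    (id ⊗₁ ℓ) ∘ (id ⊗₁ ℓ) ∘ (id ⊗₁ α) ∘ (id ⊗₁ (σ ⊗₁ id)) ∘ (id ⊗₁ α⁻¹) ∘ α
      ≈⟨ refl⟩∘⟨ refl⟩∘⟨ refl⟩∘⟨ pullˡ (≈-sym id⊗-∘) ⟩
    (id ⊗₁ ℓ) ∘ (id ⊗₁ ℓ) ∘ (id ⊗₁ α) ∘ (id ⊗₁ ((σ ⊗₁ id) ∘ α⁻¹)) ∘ α
      ≈⟨ refl⟩∘⟨ refl⟩∘⟨ pullˡ (≈-sym id⊗-∘) ⟩
    (id ⊗₁ ℓ) ∘ (id ⊗₁ ℓ) ∘ (id ⊗₁ (α ∘ (σ ⊗₁ id) ∘ α⁻¹)) ∘ α
      ≈⟨ refl⟩∘⟨ pullˡ (≈-sym id⊗-∘) ⟩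
    (id ⊗₁ ℓ) ∘ (id ⊗₁ (ℓ ∘ α ∘ (σ ⊗₁ id) ∘ α⁻¹)) ∘ α
      ≈⟨ refl⟩∘⟨ ⊗-resp-≈ʳ exchange-units ⟩∘⟨refl ⟩
    (id ⊗₁ ℓ) ∘ (id ⊗₁ (id ⊗₁ ℓ)) ∘ α
      ≈⟨ refl⟩∘⟨ α-natural ⟨
    (id ⊗₁ ℓ) ∘ α ∘ ((id ⊗₁ id) ⊗₁ ℓ)
      ≈⟨ pullˡ triangle ⟩
    (ρ ⊗₁ id) ∘ ((id ⊗₁ id) ⊗₁ ℓ)
      ≈⟨ ⊗-homomorphism ⟨
    (ρ ∘ (id ⊗₁ id)) ⊗₁ (id ∘ ℓ)
      ≈⟨ ⊗-resp-≈ (≈-trans (refl⟩∘⟨ ⊗-identity) identityʳ) identityˡ ⟩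
    ρ ⊗₁ ℓ
      ∎
    where
    exchange-units : ℓ {K ⊗₀ B} ∘ α ∘ (σ ⊗₁ id) ∘ α⁻¹ ≈ id ⊗₁ ℓ
    exchange-units = begin
      ℓ ∘ α ∘ (σ ⊗₁ id) ∘ α⁻¹      ≈⟨ pullˡ ℓ∘α≈ℓ⊗id ⟩
      (ℓ ⊗₁ id) ∘ (σ ⊗₁ id) ∘ α⁻¹  ≈⟨ pullˡ (≈-sym ∘-⊗id) ⟩
      ((ℓ ∘ σ) ⊗₁ id) ∘ α⁻¹        ≈⟨ ⊗-resp-≈ˡ ℓ∘σ≈ρ ⟩∘⟨refl ⟩
      (ρ ⊗₁ id) ∘ α⁻¹              ≈⟨ triangle⁻¹ ⟩
      id ⊗₁ ℓ                      ∎

  IsCounital : ∀ {X} → X ⇒ K → X ⇒ (X ⊗₀ X) → Set q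
  IsCounital u d = (ρ ∘ (id ⊗₁ u) ∘ d ≈ id) × (ℓ ∘ (u ⊗₁ id) ∘ d ≈ id)

  IsCounital-resp-≈ : ∀ {X} {u u' : X ⇒ K} {d : X ⇒ (X ⊗₀ X)} →
                      u ≈ u' → IsCounital u d → IsCounital u' d
  IsCounital-resp-≈ u≈u' (counitʳ , counitˡ) =
      ≈-trans (refl⟩∘⟨ ⊗-resp-≈ʳ (≈-sym u≈u') ⟩∘⟨refl) counitʳ
    , ≈-trans (refl⟩∘⟨ ⊗-resp-≈ˡ (≈-sym u≈u') ⟩∘⟨refl) counitˡ

  eckmann-hilton : ∀ {X} {u : X ⇒ K} {d d' : X ⇒ (X ⊗₀ X)} →
                   IsCounital u d → IsCounital u d' →
                   τ ∘ (d ⊗₁ d) ∘ d' ≈ (d' ⊗₁ d') ∘ d → d ≈ d'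
  eckmann-hilton {X} {u} {d} {d'} d-counital d'-counital interchange = begin
    d                          ≈⟨ cancelˡ (outer∘⊗≈id d'-counital) ⟨
    outer ∘ (d' ⊗₁ d') ∘ d     ≈⟨ refl⟩∘⟨ interchange ⟨
    outer ∘ τ ∘ (d ⊗₁ d) ∘ d'  ≈⟨ pullˡ outer∘τ≈outer ⟩
    outer ∘ (d ⊗₁ d) ∘ d'      ≈⟨ cancelˡ (outer∘⊗≈id d-counital) ⟩
    d'                         ∎
    where
    outer : ((X ⊗₀ X) ⊗₀ (X ⊗₀ X)) ⇒ (X ⊗₀ X)
    outer = (ρ ∘ (id ⊗₁ u)) ⊗₁ (ℓ ∘ (u ⊗₁ id))

    outer∘⊗≈id : ∀ {e} → IsCounital u e → outer ∘ (e ⊗₁ e) ≈ id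
    outer∘⊗≈id (counitʳ , counitˡ) = begin
      outer ∘ (_ ⊗₁ _)                                   ≈⟨ ⊗-homomorphism ⟨
      ((ρ ∘ (id ⊗₁ u)) ∘ _) ⊗₁ ((ℓ ∘ (u ⊗₁ id)) ∘ _)    ≈⟨ ⊗-resp-≈ (≈-trans assoc counitʳ) (≈-trans assoc counitˡ) ⟩
      id ⊗₁ id                                           ≈⟨ ⊗-identity ⟩
      id                                                 ∎

    outer∘τ≈outer : outer ∘ τ ≈ outer
    outer∘τ≈outer = begin
      outer ∘ τ                                   ≈⟨ ⊗-homomorphism ⟩∘⟨refl ⟩
      ((ρ ⊗₁ ℓ) ∘ ((id ⊗₁ u) ⊗₁ (u ⊗₁ id))) ∘ τ   ≈⟨ pullʳ (≈-sym τ-natural) ⟩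
      (ρ ⊗₁ ℓ) ∘ τ ∘ ((id ⊗₁ u) ⊗₁ (u ⊗₁ id))     ≈⟨ pullˡ ρ⊗ℓ∘τ≈ρ⊗ℓ ⟩
      (ρ ⊗₁ ℓ) ∘ ((id ⊗₁ u) ⊗₁ (u ⊗₁ id))         ≈⟨ ⊗-homomorphism ⟨
      outer                                       ∎

module CoalgebraProperties {o h q} {C : Category o h q} {M : SymmetricMonoidal C}
         (B : MonoidalCoalgebraModality M) where
  open Category C
  open SymmetricMonoidal M
  open MonoidalCoalgebraModality B
  open HomReasoning C
  open SymmetricMonoidalProperties M

  comult : ∀ {X} → X ⇒ !₀ X → X ⇒ (X ⊗₀ X)
  comult c = (ε ⊗₁ ε) ∘ Δ ∘ c

  counit : ∀ {X} → X ⇒ !₀ X → X ⇒ K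
  counit c = e ∘ c

  record IsCoalgebra {X} (c : X ⇒ !₀ X) : Set q where
    field
      ε-coaction : ε ∘ c ≈ id
      δ-coaction : δ ∘ c ≈ !₁ c ∘ c

  comult-natural : ∀ {X Y} {c : X ⇒ !₀ X} {c' : Y ⇒ !₀ Y} {f : X ⇒ Y} →
                   c' ∘ f ≈ !₁ f ∘ c → comult c' ∘ f ≈ (f ⊗₁ f) ∘ comult c
  comult-natural {c = c} {c'} {f} f-morphism = begin
    ((ε ⊗₁ ε) ∘ Δ ∘ c') ∘ f            ≈⟨ pullʳ (pullʳ f-morphism) ⟩
    (ε ⊗₁ ε) ∘ Δ ∘ !₁ f ∘ c            ≈⟨ refl⟩∘⟨ extendʳ Δ-natural ⟩
    (ε ⊗₁ ε) ∘ (!₁ f ⊗₁ !₁ f) ∘ Δ ∘ c  ≈⟨ extendʳ (⊗-square ε-natural ε-natural) ⟩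
    (f ⊗₁ f) ∘ (ε ⊗₁ ε) ∘ Δ ∘ c        ∎

  counit-natural : ∀ {X Y} {c : X ⇒ !₀ X} {c' : Y ⇒ !₀ Y} {f : X ⇒ Y} →
                   c' ∘ f ≈ !₁ f ∘ c → counit c' ∘ f ≈ counit c
  counit-natural f-morphism = ≈-trans (pullʳ f-morphism) (pullˡ e-natural)

  comult-δ : ∀ {A} → comult (δ {A}) ≈ Δ
  comult-δ = begin
    (ε ⊗₁ ε) ∘ Δ ∘ δ          ≈⟨ refl⟩∘⟨ δ-Δ ⟩
    (ε ⊗₁ ε) ∘ (δ ⊗₁ δ) ∘ Δ   ≈⟨ pullˡ (≈-sym ⊗-homomorphism) ⟩
    ((ε ∘ δ) ⊗₁ (ε ∘ δ)) ∘ Δ  ≈⟨ ⊗-resp-≈ ε-identityˡ ε-identityˡ ⟩∘⟨refl ⟩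
    (id ⊗₁ id) ∘ Δ            ≈⟨ ⊗-identity ⟩∘⟨refl ⟩
    id ∘ Δ                    ≈⟨ identityˡ ⟩
    Δ                         ∎

  comult-m : ∀ {X Y} {c : X ⇒ !₀ X} {c' : Y ⇒ !₀ Y} →
             comult (m ∘ (c ⊗₁ c')) ≈ τ ∘ (comult c ⊗₁ comult c')
  comult-m {c = c} {c'} = begin
    (ε ⊗₁ ε) ∘ Δ ∘ m ∘ (c ⊗₁ c')
      ≈⟨ refl⟩∘⟨ ≈-trans (pullˡ Δ-m) (pullʳ assoc) ⟩
    (ε ⊗₁ ε) ∘ (m ⊗₁ m) ∘ τ ∘ (Δ ⊗₁ Δ) ∘ (c ⊗₁ c')
      ≈⟨ pullˡ (≈-trans (≈-sym ⊗-homomorphism) (⊗-resp-≈ ε-m ε-m)) ⟩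
    ((ε ⊗₁ ε) ⊗₁ (ε ⊗₁ ε)) ∘ τ ∘ (Δ ⊗₁ Δ) ∘ (c ⊗₁ c')
      ≈⟨ extendʳ τ-natural ⟨
    τ ∘ ((ε ⊗₁ ε) ⊗₁ (ε ⊗₁ ε)) ∘ (Δ ⊗₁ Δ) ∘ (c ⊗₁ c')
      ≈⟨ refl⟩∘⟨ ⊗-homomorphism₃ ⟨
    τ ∘ (comult c ⊗₁ comult c')
      ∎

  module _ {X} {c : X ⇒ !₀ X} (coalgebra : IsCoalgebra c) where
    open IsCoalgebra coalgebra

    Δ-coaction : Δ ∘ c ≈ (c ⊗₁ c) ∘ comult c
    Δ-coaction = ≈-trans (≈-sym comult-δ ⟩∘⟨refl) (comult-natural δ-coaction)

    comult-counital : IsCounital (counit c) (comult c)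
    comult-counital = counitʳ , counitˡ
      where
      ⊗∘comult : ∀ {Y Z} {a : !₀ X ⇒ Y} {b : !₀ X ⇒ Z} →
                 ((a ∘ c) ⊗₁ (b ∘ c)) ∘ comult c ≈ (a ⊗₁ b) ∘ Δ ∘ c
      ⊗∘comult = ≈-trans (⊗-homomorphism ⟩∘⟨refl) (pullʳ (≈-sym Δ-coaction))

      counitʳ : ρ ∘ (id ⊗₁ counit c) ∘ comult c ≈ id
      counitʳ = begin
        ρ ∘ (id ⊗₁ (e ∘ c)) ∘ comult c         ≈⟨ refl⟩∘⟨ ⊗-resp-≈ˡ ε-coaction ⟩∘⟨refl ⟨
        ρ ∘ ((ε ∘ c) ⊗₁ (e ∘ c)) ∘ comult c    ≈⟨ refl⟩∘⟨ ⊗∘comult ⟩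
        ρ ∘ (ε ⊗₁ e) ∘ Δ ∘ c                   ≈⟨ refl⟩∘⟨ ⊗≈⊗id∘id⊗ ⟩∘⟨refl ⟩
        ρ ∘ ((ε ⊗₁ id) ∘ (id ⊗₁ e)) ∘ Δ ∘ c    ≈⟨ refl⟩∘⟨ assoc ⟩
        ρ ∘ (ε ⊗₁ id) ∘ (id ⊗₁ e) ∘ Δ ∘ c      ≈⟨ extendʳ ρ-natural ⟩
        ε ∘ ρ ∘ (id ⊗₁ e) ∘ Δ ∘ c              ≈⟨ refl⟩∘⟨ ≈-trans (pullˡ₃ Δ-counitʳ) identityˡ ⟩
        ε ∘ c                                  ≈⟨ ε-coaction ⟩
        id                                     ∎

      counitˡ : ℓ ∘ (counit c ⊗₁ id) ∘ comult c ≈ id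
      counitˡ = begin
        ℓ ∘ ((e ∘ c) ⊗₁ id) ∘ comult c         ≈⟨ refl⟩∘⟨ ⊗-resp-≈ʳ ε-coaction ⟩∘⟨refl ⟨
        ℓ ∘ ((e ∘ c) ⊗₁ (ε ∘ c)) ∘ comult c    ≈⟨ refl⟩∘⟨ ⊗∘comult ⟩
        ℓ ∘ (e ⊗₁ ε) ∘ Δ ∘ c                   ≈⟨ refl⟩∘⟨ ⊗≈id⊗∘⊗id ⟩∘⟨refl ⟩
        ℓ ∘ ((id ⊗₁ ε) ∘ (e ⊗₁ id)) ∘ Δ ∘ c    ≈⟨ refl⟩∘⟨ assoc ⟩
        ℓ ∘ (id ⊗₁ ε) ∘ (e ⊗₁ id) ∘ Δ ∘ c      ≈⟨ extendʳ ℓ-natural ⟩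
        ε ∘ ℓ ∘ (e ⊗₁ id) ∘ Δ ∘ c              ≈⟨ refl⟩∘⟨ ≈-trans (pullˡ₃ Δ-counitˡ) identityˡ ⟩
        ε ∘ c                                  ≈⟨ ε-coaction ⟩
        id                                     ∎

module ComonoidalFunctorProperties {o h q} {C : Category o h q} {M : SymmetricMonoidal C}
         (Tm : SymmetricComonoidalMonad M) where
  open Category C
  open SymmetricMonoidal M
  open SymmetricComonoidalMonad Tm
  open HomReasoning C
  open SymmetricMonoidalProperties M

  T-homomorphism₃ : ∀ {A B C D} {f : A ⇒ B} {g : B ⇒ C} {k : C ⇒ D} →
                    T₁ (k ∘ g ∘ f) ≈ T₁ k ∘ T₁ g ∘ T₁ f
  T-homomorphism₃ = ≈-trans homomorphism (refl⟩∘⟨ homomorphism)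

  T-counital : ∀ {X} {u : X ⇒ K} {d : X ⇒ (X ⊗₀ X)} →
               IsCounital u d → IsCounital (nK ∘ T₁ u) (n ∘ T₁ d)
  T-counital {u = u} {d} (counitʳ , counitˡ) = Tcounitʳ , Tcounitˡ
    where
    Tcounitʳ : ρ ∘ (id ⊗₁ (nK ∘ T₁ u)) ∘ n ∘ T₁ d ≈ id
    Tcounitʳ = begin
      ρ ∘ (id ⊗₁ (nK ∘ T₁ u)) ∘ n ∘ T₁ d
        ≈⟨ refl⟩∘⟨ ≈-trans (⊗-resp-≈ˡ (≈-sym (≈-trans identityˡ identity))) ⊗-homomorphism ⟩∘⟨refl ⟩
      ρ ∘ ((id ⊗₁ nK) ∘ (T₁ id ⊗₁ T₁ u)) ∘ n ∘ T₁ d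
        ≈⟨ refl⟩∘⟨ pullʳ (extendʳ (≈-sym n-natural)) ⟩
      ρ ∘ (id ⊗₁ nK) ∘ n ∘ T₁ (id ⊗₁ u) ∘ T₁ d
        ≈⟨ pullˡ₃ n-unitʳ ⟩
      T₁ ρ ∘ T₁ (id ⊗₁ u) ∘ T₁ d
        ≈⟨ T-homomorphism₃ ⟨
      T₁ (ρ ∘ (id ⊗₁ u) ∘ d)
        ≈⟨ F-resp-≈ counitʳ ⟩
      T₁ id
        ≈⟨ identity ⟩
      id
        ∎

    Tcounitˡ : ℓ ∘ ((nK ∘ T₁ u) ⊗₁ id) ∘ n ∘ T₁ d ≈ id
    Tcounitˡ = begin
      ℓ ∘ ((nK ∘ T₁ u) ⊗₁ id) ∘ n ∘ T₁ d
        ≈⟨ refl⟩∘⟨ ≈-trans (⊗-resp-≈ʳ (≈-sym (≈-trans identityˡ identity))) ⊗-homomorphism ⟩∘⟨refl ⟩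
      ℓ ∘ ((nK ⊗₁ id) ∘ (T₁ u ⊗₁ T₁ id)) ∘ n ∘ T₁ d
        ≈⟨ refl⟩∘⟨ pullʳ (extendʳ (≈-sym n-natural)) ⟩
      ℓ ∘ (nK ⊗₁ id) ∘ n ∘ T₁ (u ⊗₁ id) ∘ T₁ d
        ≈⟨ pullˡ₃ n-unitˡ ⟩
      T₁ ℓ ∘ T₁ (u ⊗₁ id) ∘ T₁ d
        ≈⟨ T-homomorphism₃ ⟨
      T₁ (ℓ ∘ (u ⊗₁ id) ∘ d)
        ≈⟨ F-resp-≈ counitˡ ⟩
      T₁ id
        ≈⟨ identity ⟩
      id
        ∎

module MixedDistributiveLawProperties {o h q} {C : Category o h q} {M : SymmetricMonoidal C}
         {Tm : SymmetricComonoidalMonad M} {B : MonoidalCoalgebraModality M}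
         (L : SymmetricMonoidalMixedDistributiveLaw Tm B) where
  open Category C
  open SymmetricMonoidal M
  open SymmetricComonoidalMonad Tm
    renaming (identity to T-identity; homomorphism to T-homomorphism; F-resp-≈ to T-resp-≈)
  open MonoidalCoalgebraModality B
    hiding (identity; F-resp-≈) renaming (homomorphism to !-homomorphism)
  open SymmetricMonoidalMixedDistributiveLaw L
  open HomReasoning C
  open SymmetricMonoidalProperties M
  open CoalgebraProperties B
  open ComonoidalFunctorProperties Tm

  κ : ∀ {A} → T₀ (!₀ A) ⇒ !₀ (T₀ (!₀ A))
  κ = lam ∘ T₁ δ

  !T-∘-κ : ∀ {A B} {f : !₀ A ⇒ B} → !₁ (T₁ f) ∘ κ ≈ lam ∘ T₁ (!₁ f ∘ δ)
  !T-∘-κ = ≈-trans (pullˡ (≈-sym lam-natural)) (pullʳ (≈-sym T-homomorphism))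

  κ-coalgebra : ∀ {A} → IsCoalgebra (κ {A})
  κ-coalgebra = record { ε-coaction = ε-coaction ; δ-coaction = δ-coaction }
    where
    ε-coaction : ε ∘ κ ≈ id
    ε-coaction = begin
      ε ∘ lam ∘ T₁ δ   ≈⟨ pullˡ lam-ε ⟩
      T₁ ε ∘ T₁ δ      ≈⟨ T-homomorphism ⟨
      T₁ (ε ∘ δ)       ≈⟨ T-resp-≈ ε-identityˡ ⟩
      T₁ id            ≈⟨ T-identity ⟩
      id               ∎

    δ-coaction : δ ∘ κ ≈ !₁ κ ∘ κ
    δ-coaction = begin
      δ ∘ lam ∘ T₁ δ                ≈⟨ pullˡ lam-δ ⟩
      (!₁ lam ∘ lam ∘ T₁ δ) ∘ T₁ δ  ≈⟨ pullʳ (pullʳ (≈-sym T-homomorphism)) ⟩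
      !₁ lam ∘ lam ∘ T₁ (δ ∘ δ)     ≈⟨ refl⟩∘⟨ refl⟩∘⟨ T-resp-≈ δ-assoc ⟩
      !₁ lam ∘ lam ∘ T₁ (!₁ δ ∘ δ)  ≈⟨ refl⟩∘⟨ !T-∘-κ ⟨
      !₁ lam ∘ !₁ (T₁ δ) ∘ κ        ≈⟨ pullˡ (≈-sym !-homomorphism) ⟩
      !₁ κ ∘ κ                      ∎

  κ-counit : ∀ {A} → counit (κ {A}) ≈ nK ∘ T₁ e
  κ-counit = begin
    counit κ                 ≈⟨ counit-natural nK∘Te-coalgebra-morphism ⟨
    (e ∘ mK) ∘ nK ∘ T₁ e     ≈⟨ e-mK ⟩∘⟨refl ⟩
    id ∘ nK ∘ T₁ e           ≈⟨ identityˡ ⟩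
    nK ∘ T₁ e                ∎
    where
    nK∘Te-coalgebra-morphism : mK ∘ nK ∘ T₁ e ≈ !₁ (nK ∘ T₁ e) ∘ κ
    nK∘Te-coalgebra-morphism = begin
      mK ∘ nK ∘ T₁ e                   ≈⟨ pullˡ (≈-sym lam-mK) ⟩
      (!₁ nK ∘ lam ∘ T₁ mK) ∘ T₁ e     ≈⟨ pullʳ (pullʳ (≈-sym T-homomorphism)) ⟩
      !₁ nK ∘ lam ∘ T₁ (mK ∘ e)        ≈⟨ refl⟩∘⟨ refl⟩∘⟨ T-resp-≈ !e-δ ⟨
      !₁ nK ∘ lam ∘ T₁ (!₁ e ∘ δ)      ≈⟨ refl⟩∘⟨ !T-∘-κ ⟨
      !₁ nK ∘ !₁ (T₁ e) ∘ κ            ≈⟨ pullˡ (≈-sym !-homomorphism) ⟩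
      !₁ (nK ∘ T₁ e) ∘ κ               ∎

  κ-comult : ∀ {A} → comult (κ {A}) ≈ n ∘ T₁ Δ
  κ-comult = eckmann-hilton
    (IsCounital-resp-≈ κ-counit (comult-counital κ-coalgebra))
    (T-counital (Δ-counitʳ , Δ-counitˡ))
    (≈-trans (pullˡ (≈-sym comult-m)) (comult-natural n∘TΔ-coalgebra-morphism))
    where
    n∘TΔ-coalgebra-morphism : (m ∘ (κ ⊗₁ κ)) ∘ n ∘ T₁ Δ ≈ !₁ (n ∘ T₁ Δ) ∘ κ
    n∘TΔ-coalgebra-morphism = begin
      (m ∘ (κ ⊗₁ κ)) ∘ n ∘ T₁ Δ
        ≈⟨ pullʳ (⊗-homomorphism ⟩∘⟨refl) ⟩
      m ∘ ((lam ⊗₁ lam) ∘ (T₁ δ ⊗₁ T₁ δ)) ∘ n ∘ T₁ Δ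
        ≈⟨ refl⟩∘⟨ pullʳ (extendʳ (≈-sym n-natural)) ⟩
      m ∘ (lam ⊗₁ lam) ∘ n ∘ T₁ (δ ⊗₁ δ) ∘ T₁ Δ
        ≈⟨ pullˡ₃ (≈-sym lam-m) ⟩
      (!₁ n ∘ lam ∘ T₁ m) ∘ T₁ (δ ⊗₁ δ) ∘ T₁ Δ
        ≈⟨ pullʳ (pullʳ (≈-sym T-homomorphism₃)) ⟩
      !₁ n ∘ lam ∘ T₁ (m ∘ (δ ⊗₁ δ) ∘ Δ)
        ≈⟨ refl⟩∘⟨ refl⟩∘⟨ T-resp-≈ !Δ-δ ⟨
      !₁ n ∘ lam ∘ T₁ (!₁ Δ ∘ δ)
        ≈⟨ refl⟩∘⟨ !T-∘-κ ⟨
      !₁ n ∘ !₁ (T₁ Δ) ∘ κ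
        ≈⟨ pullˡ (≈-sym !-homomorphism) ⟩
      !₁ (n ∘ T₁ Δ) ∘ κ
        ∎

lemma6p4 : ∀ {o h q : Level} (C : Category o h q) (M : SymmetricMonoidal C)
             (Tm : SymmetricComonoidalMonad M) (B : MonoidalCoalgebraModality M)
             (L : SymmetricMonoidalMixedDistributiveLaw Tm B) →
             IsCoalgebraMixedDistributiveLaw L
lemma6p4 C M Tm B L A = lam-Δ , lam-e
  where
  open Category C
  open SymmetricMonoidal M
  open SymmetricComonoidalMonad Tm
  open MonoidalCoalgebraModality B
  open SymmetricMonoidalMixedDistributiveLaw L
  open HomReasoning C
  open CoalgebraProperties B
  open MixedDistributiveLawProperties L

  lam-Δ : Δ ∘ lam {A} ≈ (lam ⊗₁ lam) ∘ n ∘ T₁ Δ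
  lam-Δ = begin
    Δ ∘ lam                    ≈⟨ comult-δ ⟩∘⟨refl ⟨
    comult δ ∘ lam             ≈⟨ comult-natural lam-δ ⟩
    (lam ⊗₁ lam) ∘ comult κ    ≈⟨ refl⟩∘⟨ κ-comult ⟩
    (lam ⊗₁ lam) ∘ n ∘ T₁ Δ    ∎

  lam-e : e ∘ lam {A} ≈ nK ∘ T₁ e
  lam-e = begin
    e ∘ lam          ≈⟨ δ-e ⟩∘⟨refl ⟨
    counit δ ∘ lam   ≈⟨ counit-natural lam-δ ⟩
    counit κ         ≈⟨ κ-counit ⟩
    nK ∘ T₁ e        ∎
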